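{- Let $k\ge 3$ and $e\ge 3$. Suppose there exists a strongly equitable uniquely $(k-1)$-chromatic $e$-star system of order $n_{k-1}\equiv 0\pmod{2e}$ whose colour classes $C_1,\dots,C_{k-1}$ satisfy $|C_i|>e$ for $1\le i\le k-1$. Then there exists a strongly equitable $k$-chromatic $e$-star system of some order $n_k\equiv 0\pmod{2e}$.
   Context: An $e$-star is the complete bipartite graph $K_{1,e}$. An $e$-star system of order $n$ is a pair $(V,\mathcal B)$ where $|V|=n$ and $\mathcal B$ is a set of $e$-stars (subgraphs of the complete graph $K_n$ on $V$) whose edge sets partition the edge set of $K_n$. An $e$-star system is $k$-colourable if $V$ can be partitioned into $k$ sets (colour classes) such that no star in $\mathcal B$ has all its vertices in the same class; it is $k$-chromatic if it is $k$-colourable but not $(k-1)$-colourable. It is uniquely $k$-colourable if any two $k$-colourings differ only by a permutation of the colours. A colouring is strongly equitable if all colour classes have the same size. A strongly equitable (uniquely) $k$-chromatic system is a (uniquely colourable) $k$-chromatic system admitting a strongly equitable $k$-colouring. -}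

module Defs where

open import Data.Nat using (ℕ; _<_)
open import Data.Fin using (Fin; _≟_)
open import Data.Fin.Permutation using (Permutation′; _⟨$⟩ʳ_)
open import Data.Vec using (Vec)
open import Data.Vec.Membership.Propositional using () renaming (_∈_ to _∈ᵥ_)
open import Data.Vec.Relation.Unary.Unique.Propositional using () renaming (Unique to UniqueV)
open import Data.Vec.Relation.Unary.All using () renaming (All to AllV)
open import Data.List using (List; length; filter; allFin; lookup)
open import Data.Product using (Σ; _×_; ∃; ∃-syntax)
open import Data.Sum using (_⊎_)
open import Relation.Nullary using (¬_)
open import Relation.Binary.PropositionalEquality using (_≡_; _≢_)

record Star (n e : ℕ) : Set where
  constructor star
  field
    centre       : Fin n
    leaves       : Vec (Fin n) e
    leavesUnique : UniqueV leaves
    leavesNotC   : AllV (λ l → l ≢ centre) leaves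
open Star public

EdgeOf : ∀ {n e} → Fin n → Fin n → Star n e → Set
EdgeOf u v s = (centre s ≡ u × v ∈ᵥ leaves s) ⊎ (centre s ≡ v × u ∈ᵥ leaves s)

record StarSystem (n e : ℕ) : Set where
  field
    blocks    : List (Star n e)
    partition : ∀ (u v : Fin n) → u ≢ v →
                Σ (Fin (length blocks)) λ i →
                  EdgeOf u v (lookup blocks i) ×
                  (∀ j → EdgeOf u v (lookup blocks j) → j ≡ i)
open StarSystem public

Proper : ∀ {n e} → StarSystem n e → (k : ℕ) → (Fin n → Fin k) → Set
Proper S k f = ∀ (i : Fin (length (blocks S))) →
  ¬ AllV (λ l → f l ≡ f (centre (lookup (blocks S) i))) (leaves (lookup (blocks S) i))

Colourable : ∀ {n e} → StarSystem n e → ℕ → Set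
Colourable {n} S k = ∃[ f ] Proper S k f

Chromatic : ∀ {n e} → StarSystem n e → ℕ → Set
Chromatic S k = Colourable S k × ¬ Colourable S (k Data.Nat.∸ 1)

UniquelyColourable : ∀ {n e} → StarSystem n e → ℕ → Set
UniquelyColourable {n} S k = ∀ f g → Proper S k f → Proper S k g →
  Σ (Permutation′ k) λ π → ∀ (v : Fin n) → g v ≡ (π ⟨$⟩ʳ f v)

classSize : ∀ {n k} → (Fin n → Fin k) → Fin k → ℕ
classSize {n} f i = length (filter (λ v → f v ≟ i) (allFin n))

StronglyEquitable : ∀ {n k} → (Fin n → Fin k) → Set
StronglyEquitable f = ∀ i j → classSize f i ≡ classSize f j

-- Take k = K + 1 copies of S and colour copy a by punchIn a ∘ f, so that copy a misses
-- colour a and every colour class has K m vertices. Edges inside a copy are covered by the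
-- copies of the stars of S. For copies a < b, the edges from a vertex x of copy a to copy b
-- are covered by stars centred at x whose leaf sets are the blocks of a partition of copy b
-- into e-sets. If x has colour b, the missing colour of copy b, these stars are never
-- monochromatic and the partition is chosen so that every colour class of f contains a
-- whole block; otherwise every block is chosen to meet two colour classes. A proper
-- K-colouring would restrict on each copy a to π a ∘ f for some permutation π a, by unique
-- colourability; taking x₀ in copy 0 and b = suc (f x₀), the block of copy b inside the
-- class π b ⁻¹ (π 0 (f x₀)) of f would then give a monochromatic star.
module Submission where

open import Defs
open import Data.Nat using (ℕ; _≤_; _<_; _*_; _∸_)
open import Data.Nat.Divisibility using (_∣_)
open import Data.Fin using (Fin)
open import Data.Product using (Σ; _×_; ∃-syntax)

open import Data.Nat using (zero; suc; _+_; z≤n; s≤s; NonZero)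
import Data.Nat.Properties as ℕ
open import Data.Nat.DivMod using (_%_; m*n%n≡0; [m+kn]%n≡m%n; m<n⇒m%n≡m)
open import Data.Nat.Divisibility using (∣-trans; n∣m*n; ∣n⇒∣m*n; ∣m+n∣m⇒∣n)
open import Data.Bool using (true; false; if_then_else_)
open import Data.Empty using (⊥; ⊥-elim)
open import Data.Fin as Fin
  using (zero; suc; toℕ; cast; combine; remQuot; punchIn; punchOut; _↑ˡ_; _↑ʳ_; _≟_; _<?_)
import Data.Fin.Properties as Fin
open import Data.Fin.Permutation using (Permutation′; _⟨$⟩ʳ_; _⟨$⟩ˡ_; inverseʳ; cast-id; ↔⇒≡)
open import Data.List as List using (List; _∷_; map; length; filter; allFin; cartesianProduct; _++_)
open import Data.List.Properties using (length-map)
open import Data.List.Membership.Propositional using (_∈_)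
import Data.List.Membership.Propositional.Properties as ∈
open import Data.List.Relation.Unary.Any using (index)
import Data.List.Relation.Unary.Any.Properties as Any
import Data.List.Relation.Unary.All as All
open import Data.List.Relation.Unary.AllPairs using (_∷_)
open import Data.List.Relation.Unary.Unique.Propositional using (Unique)
import Data.List.Relation.Unary.Unique.Propositional.Properties as Unique
open import Data.Vec as Vec using (tabulate)
import Data.Vec.Membership.Propositional.Properties as ∈ᵥ
import Data.Vec.Relation.Unary.Any as AnyV
import Data.Vec.Relation.Unary.Any.Properties as AnyVₚ
import Data.Vec.Relation.Unary.All as AllV
import Data.Vec.Relation.Unary.All.Properties as AllVₚ
import Data.Vec.Relation.Unary.Unique.Propositional.Properties as UniqueV
open import Data.Product using (_,_; proj₁; proj₂; uncurry)
open import Data.Product.Algebra using (×-cong; ×-comm; ×-distribˡ-⊎; ×-distribʳ-⊎)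
open import Data.Sum as Sum using (_⊎_; inj₁; inj₂)
open import Data.Sum.Algebra using (⊎-cong)
open import Data.Sum.Properties using (inj₁-injective; inj₂-injective)
open import Function using (_∘_; _↔_; _⇔_; mk⇔; mk↔ₛ′; Injective; Inverse)
open import Function.Bundles using (Injection)
open import Function.Properties.Inverse using (↔-refl; ↔-sym; ↔-trans; ↔⇒↣)
open import Level using (0ℓ)
open import Relation.Nullary using (¬_; Dec; does; yes; no)
open import Relation.Nullary.Decidable using (dec-false; does-⇔)
open import Relation.Unary using (Pred; Decidable)
open import Relation.Binary.Definitions using (tri<; tri≈; tri>)
open import Relation.Binary.PropositionalEquality
open Inverse using (to; from; strictlyInverseˡ)

m*n≢1+m*o : ∀ m .{{_ : NonZero m}} → 2 ≤ m → ∀ n o → m * n ≢ suc (m * o)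
m*n≢1+m*o m 2≤m n o eq = ℕ.0≢1+n (begin
  0               ≡⟨ m*n%n≡0 n m ⟨
  (n * m) % m     ≡⟨ cong (_% m) (trans (ℕ.*-comm n m) eq) ⟩
  suc (m * o) % m ≡⟨ cong (λ t → suc t % m) (ℕ.*-comm m o) ⟩
  (1 + o * m) % m ≡⟨ [m+kn]%n≡m%n 1 o m ⟩
  1 % m           ≡⟨ m<n⇒m%n≡m 2≤m ⟩
  1               ∎)
  where open ≡-Reasoning

∣m*[n+o]⇒∣m*o : ∀ m {n o} → n ∣ m * (n + o) → n ∣ m * o
∣m*[n+o]⇒∣m*o m {n} {o} n∣m*[n+o] =
  ∣m+n∣m⇒∣n (subst (n ∣_) (ℕ.*-distribˡ-+ m n o) n∣m*[n+o]) (n∣m*n m)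

cast-injective : ∀ {m n} .(eq : m ≡ n) {i j : Fin m} → cast eq i ≡ cast eq j → i ≡ j
cast-injective eq {i} {j} castᵢ≡castⱼ =
  Fin.toℕ-injective (trans (sym (Fin.toℕ-cast eq i))
    (trans (cong toℕ castᵢ≡castⱼ) (Fin.toℕ-cast eq j)))

toℕ-remQuot : ∀ {m} n (i : Fin (m * n)) →
  toℕ i ≡ n * toℕ (proj₁ (remQuot {m} n i)) + toℕ (proj₂ (remQuot {m} n i))
toℕ-remQuot {m} n i = trans (cong toℕ (sym (Fin.combine-remQuot {m} n i)))
  (Fin.toℕ-combine (proj₁ (remQuot {m} n i)) (proj₂ (remQuot {m} n i)))

remQuot-suc-remainder≢ : ∀ {m} n .{{_ : NonZero n}} → 2 ≤ n → (i j : Fin (m * n)) →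
  toℕ j ≡ suc (toℕ i) → proj₂ (remQuot {m} n i) ≢ proj₂ (remQuot {m} n j)
remQuot-suc-remainder≢ {m} n 2≤n i j j≡1+i rem≡ =
  m*n≢1+m*o n 2≤n (quot j) (quot i) (ℕ.+-cancelʳ-≡ (rem j) _ _ (begin
    n * quot j + rem j       ≡⟨ toℕ-remQuot {m} n j ⟨
    toℕ j                    ≡⟨ j≡1+i ⟩
    suc (toℕ i)              ≡⟨ cong suc (toℕ-remQuot {m} n i) ⟩
    suc (n * quot i + rem i) ≡⟨ cong (λ t → suc (n * quot i + toℕ t)) rem≡ ⟩
    suc (n * quot i) + rem j ∎))
  where
  open ≡-Reasoning
  quot rem : Fin (m * n) → ℕ
  quot t = toℕ (proj₁ (remQuot {m} n t))
  rem  t = toℕ (proj₂ (remQuot {m} n t))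

-- Entry s of block j is position p = e j + s of Fin (m * K), read as (colour , rank) = (p mod K , p div K);
-- so consecutive positions, in particular the first two entries of a block, have different colours.
roundRobinLayout : ∀ {c e} K m → c * e ≡ m * K → (Fin c × Fin e) ↔ (Fin K × Fin m)
roundRobinLayout K m eq =
  ↔-trans (↔-sym Fin.*↔×) (↔-trans (cast-id eq) (↔-trans Fin.*↔× (×-comm _ _)))

roundRobinLayout-mixed : ∀ {c e K m} .{{_ : NonZero K}} → 2 ≤ K →
  (eq : c * suc (suc e) ≡ m * K) (j : Fin c) →
  proj₁ (to (roundRobinLayout K m eq) (j , zero)) ≢ proj₁ (to (roundRobinLayout K m eq) (j , suc zero))
roundRobinLayout-mixed {e = e} {K} {m} 2≤K eq j =
  remQuot-suc-remainder≢ {m} K 2≤K (cast eq (combine j zero)) (cast eq (combine j (suc zero))) (begin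
    toℕ (cast eq (combine j (suc zero)))  ≡⟨ Fin.toℕ-cast eq _ ⟩
    toℕ (combine j (suc {suc e} zero))    ≡⟨ Fin.toℕ-combine j (suc zero) ⟩
    suc (suc e) * toℕ j + 1               ≡⟨ ℕ.+-suc _ 0 ⟩
    suc (suc (suc e) * toℕ j + 0)         ≡⟨ cong suc (Fin.toℕ-combine j zero) ⟨
    suc (toℕ (combine j (zero {suc e})))  ≡⟨ cong suc (Fin.toℕ-cast eq _) ⟨
    suc (toℕ (cast eq (combine j zero)))  ∎)
  where open ≡-Reasoning

-- The first K blocks hold the first e members of each colour class;
-- the remaining K r vertices are spread over the last c′ blocks.
sortedLayout : ∀ {K c′ e r} → c′ * e ≡ K * r → (Fin (K + c′) × Fin e) ↔ (Fin K × Fin (e + r))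
sortedLayout {K} {c′} {e} {r} eq =
  ↔-trans (×-cong Fin.+↔⊎ ↔-refl)
  (↔-trans (×-distribʳ-⊎ 0ℓ (Fin e) (Fin K) (Fin c′))
  (↔-trans (⊎-cong ↔-refl (↔-trans (↔-sym Fin.*↔×) (↔-trans (cast-id eq) Fin.*↔×)))
  (↔-trans (↔-sym (×-distribˡ-⊎ 0ℓ (Fin K) (Fin e) (Fin r)))
  (×-cong ↔-refl (↔-sym Fin.+↔⊎)))))

sortedLayout-pure : ∀ {K c′ e r} (eq : c′ * e ≡ K * r) (i : Fin K) (s : Fin e) →
  proj₁ (to (sortedLayout eq) (i ↑ˡ c′ , s)) ≡ i
sortedLayout-pure {K} {c′} eq i s rewrite Fin.splitAt-↑ˡ K i c′ = refl

count : ∀ {n} {P : Pred (Fin n) 0ℓ} → Decidable P → ℕ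
count {zero}  P? = 0
count {suc n} P? = (if does (P? zero) then 1 else 0) + count (P? ∘ suc)

length-filter-tabulate : ∀ {A : Set} {P : Pred A 0ℓ} (P? : Decidable P) {n} (h : Fin n → A) →
  length (filter P? (List.tabulate h)) ≡ count (P? ∘ h)
length-filter-tabulate P? {zero}  h = refl
length-filter-tabulate P? {suc n} h with does (P? (h zero))
... | true  = cong suc (length-filter-tabulate P? (h ∘ suc))
... | false = length-filter-tabulate P? (h ∘ suc)

classSize≡count : ∀ {n k} (f : Fin n → Fin k) i → classSize f i ≡ count (λ v → f v ≟ i)
classSize≡count f i = length-filter-tabulate (λ v → f v ≟ i) (λ v → v)

count-⇔ : ∀ {n} {P Q : Pred (Fin n) 0ℓ} (P? : Decidable P) (Q? : Decidable Q) →
  (∀ i → P i ⇔ Q i) → count P? ≡ count Q?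
count-⇔ {zero}  P? Q? P⇔Q = refl
count-⇔ {suc n} P? Q? P⇔Q =
  cong₂ (λ b c → (if b then 1 else 0) + c) (does-⇔ (P⇔Q zero) (P? zero) (Q? zero))
    (count-⇔ (P? ∘ suc) (Q? ∘ suc) (P⇔Q ∘ suc))

count-none : ∀ {n} {P : Pred (Fin n) 0ℓ} (P? : Decidable P) → (∀ i → ¬ P i) → count P? ≡ 0
count-none {zero}  P? ¬P = refl
count-none {suc n} P? ¬P rewrite dec-false (P? zero) (¬P zero) = count-none (P? ∘ suc) (¬P ∘ suc)

count-↑ : ∀ m {n} {P : Pred (Fin (m + n)) 0ℓ} (P? : Decidable P) →
  count P? ≡ count (P? ∘ (_↑ˡ n)) + count (P? ∘ (m ↑ʳ_))
count-↑ zero    P? = refl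
count-↑ (suc m) {n} P? = trans (cong (head +_) (count-↑ m (P? ∘ suc)))
  (sym (ℕ.+-assoc head (count (P? ∘ suc ∘ (_↑ˡ n))) (count (P? ∘ suc ∘ (m ↑ʳ_)))))
  where head = if does (P? zero) then 1 else 0

count-combine-uniform : ∀ k {n c} {P : Pred (Fin (k * n)) 0ℓ} (P? : Decidable P) →
  (∀ a → count (P? ∘ combine {k} {n} a) ≡ c) → count P? ≡ k * c
count-combine-uniform zero    P? uniform = refl
count-combine-uniform (suc k) {n} P? uniform = trans (count-↑ n P?)
  (cong₂ _+_ (uniform zero) (count-combine-uniform k (P? ∘ (n ↑ʳ_)) (uniform ∘ suc)))

count-combine-missing : ∀ k {n c} {P : Pred (Fin (suc k * n)) 0ℓ} (P? : Decidable P) a₀ →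
  count (P? ∘ combine {suc k} {n} a₀) ≡ 0 →
  (∀ a → a ≢ a₀ → count (P? ∘ combine {suc k} {n} a) ≡ c) → count P? ≡ k * c
count-combine-missing k {n} P? zero none others = trans (count-↑ n P?)
  (cong₂ _+_ none (count-combine-uniform k (P? ∘ (n ↑ʳ_)) (λ a → others (suc a) λ ())))
count-combine-missing (suc k) {n} P? (suc a₀) none others = trans (count-↑ n P?)
  (cong₂ _+_ (others zero λ ())
    (count-combine-missing k (P? ∘ (n ↑ʳ_)) a₀ none
      (λ a a≢a₀ → others (suc a) (a≢a₀ ∘ Fin.suc-injective))))

lookup-injective : ∀ {A : Set} {xs : List A} → Unique xs →
  ∀ i j → List.lookup xs i ≡ List.lookup xs j → i ≡ j
lookup-injective (_ ∷ _)      zero    zero    _  = refl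
lookup-injective (x∉xs ∷ _)   zero    (suc j) eq = ⊥-elim (All.lookup x∉xs (∈.∈-lookup j) eq)
lookup-injective (x∉xs ∷ _)   (suc i) zero    eq = ⊥-elim (All.lookup x∉xs (∈.∈-lookup i) (sym eq))
lookup-injective (_ ∷ unique) (suc i) (suc j) eq = cong suc (lookup-injective unique i j eq)

module ClassEnumeration {n K m : ℕ} (f : Fin n → Fin K) (classSize≡m : ∀ i → classSize f i ≡ m)
  where

  members : Fin K → List (Fin n)
  members i = filter (λ v → f v ≟ i) (allFin n)

  member : Fin K → Fin m → Fin n
  member i r = List.lookup (members i) (cast (sym (classSize≡m i)) r)

  f-member : ∀ i r → f (member i r) ≡ i
  f-member i r = proj₂ (∈.∈-filter⁻ (λ v → f v ≟ i) {xs = allFin n} (∈.∈-lookup _))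

  member-injective : ∀ i r s → member i r ≡ member i s → r ≡ s
  member-injective i r s eq = cast-injective (sym (classSize≡m i))
    (lookup-injective (Unique.filter⁺ (λ v → f v ≟ i) (Unique.allFin⁺ n)) _ _ eq)

  rank : Fin n → Fin m
  rank v = cast (classSize≡m (f v)) (index (∈.∈-filter⁺ (λ w → f w ≟ f v) (∈.∈-allFin v) refl))

  member-rank : ∀ v → member (f v) (rank v) ≡ v
  member-rank v = trans
    (cong (List.lookup (members (f v)))
      (Fin.cast-involutive (sym (classSize≡m (f v))) (classSize≡m (f v)) _))
    (sym (Any.lookup-index (∈.∈-filter⁺ (λ w → f w ≟ f v) (∈.∈-allFin v) refl)))

  rank-member : ∀ i r → rank (member i r) ≡ r
  rank-member i r = member-injective i _ _
    (subst (λ j → member j (rank (member i r)) ≡ member i r) (f-member i r) (member-rank (member i r)))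

  enumeration : (Fin K × Fin m) ↔ Fin n
  enumeration = mk↔ₛ′ (uncurry member) (λ v → f v , rank v) member-rank
    (λ (i , r) → cong₂ _,_ (f-member i r) (rank-member i r))

  order : K * m ≡ n
  order = ↔⇒≡ (↔-trans Fin.*↔× enumeration)

Monochromatic : ∀ {N e k} → (Fin N → Fin k) → Star N e → Set
Monochromatic g s = AllV.All (λ l → g l ≡ g (centre s)) (leaves s)

EdgeOf-sym : ∀ {N e} {u v : Fin N} {s : Star N e} → EdgeOf u v s → EdgeOf v u s
EdgeOf-sym = Sum.swap

EdgeOf-≢ : ∀ {N e} {u v : Fin N} {s : Star N e} → EdgeOf u v s → u ≢ v
EdgeOf-≢ {s = s} (inj₁ (refl , v∈)) refl = AllV.lookup (leavesNotC s) v∈ refl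
EdgeOf-≢ {s = s} (inj₂ (refl , u∈)) refl = AllV.lookup (leavesNotC s) u∈ refl

module TabulatedStar {N e} (c : Fin N) (h : Fin e → Fin N)
  (h-injective : Injective _≡_ _≡_ h) (h≢c : ∀ s → h s ≢ c) where

  tabulatedStar : Star N e
  tabulatedStar = star c (tabulate h) (UniqueV.tabulate⁺ h-injective) (AllVₚ.tabulate⁺ h≢c)

  edge⁺ : ∀ s → EdgeOf c (h s) tabulatedStar
  edge⁺ s = inj₁ (refl , ∈ᵥ.∈-tabulate⁺ h s)

  edge⁻ : ∀ {u v} → EdgeOf u v tabulatedStar → ∃[ s ] ((u ≡ c × v ≡ h s) ⊎ (v ≡ c × u ≡ h s))
  edge⁻ (inj₁ (refl , v∈)) with AnyVₚ.tabulate⁻ v∈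
  ... | s , v≡hs = s , inj₁ (refl , v≡hs)
  edge⁻ (inj₂ (refl , u∈)) with AnyVₚ.tabulate⁻ u∈
  ... | s , u≡hs = s , inj₂ (refl , u≡hs)

  monochromatic⁺ : ∀ {k} {g : Fin N → Fin k} →
    (∀ s → g (h s) ≡ g c) → Monochromatic g tabulatedStar
  monochromatic⁺ = AllVₚ.tabulate⁺

  monochromatic⁻ : ∀ {k} {g : Fin N → Fin k} →
    Monochromatic g tabulatedStar → ∀ s → g (h s) ≡ g c
  monochromatic⁻ = AllVₚ.tabulate⁻

module IndexedStarSystem {N e} {I : Set} (blockAt : I → Star N e)
  (indices : List I) (indices-unique : Unique indices)
  (covered : ∀ u v → u ≢ v → ∃[ i ] (i ∈ indices × EdgeOf u v (blockAt i)))
  (covered-once : ∀ {u v i j} → i ∈ indices → j ∈ indices →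
                  EdgeOf u v (blockAt i) → EdgeOf u v (blockAt j) → i ≡ j)
  where

  Position : Set
  Position = Fin (length (map blockAt indices))

  indexAt : (xs : List I) → Fin (length (map blockAt xs)) → I
  indexAt xs j = List.lookup xs (cast (length-map blockAt xs) j)

  lookup-map : ∀ xs j → List.lookup (map blockAt xs) j ≡ blockAt (indexAt xs j)
  lookup-map (x ∷ xs) zero    = refl
  lookup-map (x ∷ xs) (suc j) = lookup-map xs j

  position : ∀ {i} → i ∈ indices → ∃[ j ] (indexAt indices j ≡ i)
  position i∈ = cast (sym (length-map blockAt indices)) (index i∈) ,
    trans (cong (List.lookup indices) (Fin.cast-involutive (length-map blockAt indices) _ _))
          (sym (Any.lookup-index i∈))

  indexAt-injective : ∀ j j′ → indexAt indices j ≡ indexAt indices j′ → j ≡ j′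
  indexAt-injective j j′ eq =
    cast-injective (length-map blockAt indices) (lookup-injective indices-unique _ _ eq)

  system : StarSystem N e
  system = record { blocks = map blockAt indices ; partition = partition′ }
    where
    partition′ : ∀ u v → u ≢ v → Σ Position λ j →
      EdgeOf u v (List.lookup (map blockAt indices) j) ×
      (∀ j′ → EdgeOf u v (List.lookup (map blockAt indices) j′) → j′ ≡ j)
    partition′ u v u≢v with covered u v u≢v
    ... | i , i∈ , uv∈i with position i∈
    ... | j , refl = j , subst (EdgeOf u v) (sym (lookup-map indices j)) uv∈i ,
      λ j′ uv∈j′ → indexAt-injective j′ j
        (covered-once (∈.∈-lookup _) i∈ (subst (EdgeOf u v) (lookup-map indices j′) uv∈j′) uv∈i)

  proper⁺ : ∀ {k} (g : Fin N → Fin k) →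
    (∀ {i} → i ∈ indices → ¬ Monochromatic g (blockAt i)) → Proper system k g
  proper⁺ g not-mono j =
    subst (λ s → ¬ Monochromatic g s) (sym (lookup-map indices j)) (not-mono (∈.∈-lookup _))

  proper⁻ : ∀ {k} (g : Fin N → Fin k) →
    Proper system k g → ∀ {i} → i ∈ indices → ¬ Monochromatic g (blockAt i)
  proper⁻ g proper i∈ with position i∈
  ... | j , refl = subst (λ s → ¬ Monochromatic g s) (lookup-map indices j) (proper j)

-- Since n = (K + c′) e, every copy splits into c = K + c′ blocks of size e.
module Construction {K₀ e₀ n r c′ : ℕ} (S : StarSystem n (suc (suc e₀)))
  (f : Fin n → Fin (suc (suc K₀))) (f-proper : Proper S (suc (suc K₀)) f)
  (classSize≡e+r : ∀ i → classSize f i ≡ suc (suc e₀) + r)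
  (c′e≡Kr : c′ * suc (suc e₀) ≡ suc (suc K₀) * r) where

  K e m k c : ℕ
  K = suc (suc K₀)
  e = suc (suc e₀)
  m = e + r
  k = suc K
  c = K + c′

  open ClassEnumeration f classSize≡e+r using (enumeration; f-member)

  sorted : (Fin c × Fin e) ↔ Fin n
  sorted = ↔-trans (sortedLayout c′e≡Kr) enumeration

  sorted-pure : ∀ i s → f (to sorted (i ↑ˡ c′ , s)) ≡ i
  sorted-pure i s = trans (f-member _ _) (sortedLayout-pure c′e≡Kr i s)

  ce≡mK : c * e ≡ m * K
  ce≡mK = begin
    (K + c′) * e    ≡⟨ ℕ.*-distribʳ-+ e K c′ ⟩
    K * e + c′ * e  ≡⟨ cong (K * e +_) c′e≡Kr ⟩
    K * e + K * r   ≡⟨ ℕ.*-distribˡ-+ K e r ⟨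
    K * m           ≡⟨ ℕ.*-comm K m ⟩
    m * K           ∎
    where open ≡-Reasoning

  roundRobin : (Fin c × Fin e) ↔ Fin n
  roundRobin = ↔-trans (roundRobinLayout K m ce≡mK) enumeration

  roundRobin-mixed : ∀ j → f (to roundRobin (j , zero)) ≢ f (to roundRobin (j , suc zero))
  roundRobin-mixed j f≡ = roundRobinLayout-mixed (s≤s (s≤s z≤n)) ce≡mK j
    (trans (sym (f-member _ _)) (trans f≡ (f-member _ _)))

  -- The sorted layout, in which every colour class of f contains a whole block, is only used when
  -- the centre's colour punchIn a (f x) is punchIn a d, the colour missing from the target copy.
  layout : Fin n → Fin K → (Fin c × Fin e) ↔ Fin n
  layout x d with f x ≟ d
  ... | yes _ = sorted
  ... | no _  = roundRobin

  layout-pure : ∀ {x d} → f x ≡ d → ∀ i s → f (to (layout x d) (i ↑ˡ c′ , s)) ≡ i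
  layout-pure {x} {d} fx≡d with f x ≟ d
  ... | yes _   = sorted-pure
  ... | no fx≢d = ⊥-elim (fx≢d fx≡d)

  layout-mixed : ∀ {x d} → f x ≢ d →
    ∀ j → f (to (layout x d) (j , zero)) ≢ f (to (layout x d) (j , suc zero))
  layout-mixed {x} {d} fx≢d with f x ≟ d
  ... | yes fx≡d = ⊥-elim (fx≢d fx≡d)
  ... | no _     = roundRobin-mixed

  colouring : Fin (k * n) → Fin k
  colouring v = uncurry (λ a x → punchIn a (f x)) (remQuot n v)

  colouring-combine : ∀ a x → colouring (combine a x) ≡ punchIn a (f x)
  colouring-combine a x = cong (uncurry (λ a x → punchIn a (f x))) (Fin.remQuot-combine {k} {n} a x)

  copyOf : Fin (k * n) → Fin k
  copyOf v = proj₁ (remQuot n v)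

  copyOf-combine : ∀ a x → copyOf (combine a x) ≡ a
  copyOf-combine a x = cong proj₁ (Fin.remQuot-combine {k} {n} a x)

  copyLeaf : Fin k → Star n e → Fin e → Fin (k * n)
  copyLeaf a s = combine a ∘ Vec.lookup (leaves s)

  copyLeaf-injective : ∀ a s → Injective _≡_ _≡_ (copyLeaf a s)
  copyLeaf-injective a s {t} {t′} eq =
    UniqueV.lookup-injective (leavesUnique s) t t′ (Fin.combine-injectiveʳ a _ a _ eq)

  copyLeaf≢centre : ∀ a s t → copyLeaf a s t ≢ combine a (centre s)
  copyLeaf≢centre a s t eq = AllVₚ.lookup⁺ (leavesNotC s) t (Fin.combine-injectiveʳ a _ a _ eq)

  module CopyStar (a : Fin k) (s : Star n e) =
    TabulatedStar (combine a (centre s)) (copyLeaf a s) (copyLeaf-injective a s) (copyLeaf≢centre a s)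

  copyStar : Fin k → Star n e → Star (k * n) e
  copyStar = CopyStar.tabulatedStar

  -- (a , d , x , j) is the star centred at x in copy a whose leaves are
  -- block j of copy punchIn a d, in the layout chosen for x and d.
  Cross : Set
  Cross = Fin k × Fin K × Fin n × Fin c

  source target : Cross → Fin k
  source (a , _)     = a
  target (a , d , _) = punchIn a d

  crossCentre : Cross → Fin (k * n)
  crossCentre q@(_ , _ , x , _) = combine (source q) x

  crossLeaf : Cross → Fin e → Fin (k * n)
  crossLeaf q@(_ , d , x , j) s = combine (target q) (to (layout x d) (j , s))

  crossLeaf-injective : ∀ q → Injective _≡_ _≡_ (crossLeaf q)
  crossLeaf-injective q@(_ , d , x , j) {s} {s′} eq = cong proj₂
    (Injection.injective (↔⇒↣ (layout x d)) {j , s} {j , s′}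
      (Fin.combine-injectiveʳ (target q) _ (target q) _ eq))

  crossLeaf≢crossCentre : ∀ q s → crossLeaf q s ≢ crossCentre q
  crossLeaf≢crossCentre q@(a , d , x , _) s eq =
    Fin.punchInᵢ≢i a d (Fin.combine-injectiveˡ (target q) _ a x eq)

  module CrossStar (q : Cross) =
    TabulatedStar (crossCentre q) (crossLeaf q) (crossLeaf-injective q) (crossLeaf≢crossCentre q)

  crossStar : Cross → Star (k * n) e
  crossStar = CrossStar.tabulatedStar

  B : ℕ
  B = length (blocks S)

  block : Fin B → Star n e
  block = List.lookup (blocks S)

  Index : Set
  Index = (Fin k × Fin B) ⊎ Cross

  blockAt : Index → Star (k * n) e
  blockAt (inj₁ (a , i)) = copyStar a (block i)
  blockAt (inj₂ q)       = crossStar q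

  Forward : Cross → Set
  Forward q = source q Fin.< target q

  forward? : ∀ q → Dec (Forward q)
  forward? q = source q <? target q

  copies : List (Fin k × Fin B)
  copies = cartesianProduct (allFin k) (allFin B)

  crosses : List Cross
  crosses =
    cartesianProduct (allFin k) (cartesianProduct (allFin K) (cartesianProduct (allFin n) (allFin c)))

  indices : List Index
  indices = map inj₁ copies ++ map inj₂ (filter forward? crosses)

  indices-unique : Unique indices
  indices-unique = Unique.++⁺
    (Unique.map⁺ inj₁-injective (Unique.cartesianProduct⁺ (Unique.allFin⁺ k) (Unique.allFin⁺ B)))
    (Unique.map⁺ inj₂-injective (Unique.filter⁺ forward?
      (Unique.cartesianProduct⁺ (Unique.allFin⁺ k) (Unique.cartesianProduct⁺ (Unique.allFin⁺ K)
        (Unique.cartesianProduct⁺ (Unique.allFin⁺ n) (Unique.allFin⁺ c))))))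
    λ (∈copies , ∈crosses) → inj₁≢inj₂ (∈.∈-map⁻ inj₁ ∈copies) (∈.∈-map⁻ inj₂ ∈crosses)
    where
    inj₁≢inj₂ : ∀ {i} → ∃[ p ] (p ∈ copies × i ≡ inj₁ p) →
      ∃[ q ] (q ∈ filter forward? crosses × i ≡ inj₂ q) → ⊥
    inj₁≢inj₂ (_ , _ , refl) (_ , _ , ())

  copy-∈ : ∀ a i → inj₁ (a , i) ∈ indices
  copy-∈ a i = ∈.∈-++⁺ˡ (∈.∈-map⁺ inj₁ (∈.∈-cartesianProduct⁺ (∈.∈-allFin a) (∈.∈-allFin i)))

  cross-∈ : ∀ q → Forward q → inj₂ q ∈ indices
  cross-∈ (a , d , x , j) forward = ∈.∈-++⁺ʳ (map inj₁ copies) (∈.∈-map⁺ inj₂ (∈.∈-filter⁺ forward?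
    (∈.∈-cartesianProduct⁺ (∈.∈-allFin a) (∈.∈-cartesianProduct⁺ (∈.∈-allFin d)
      (∈.∈-cartesianProduct⁺ (∈.∈-allFin x) (∈.∈-allFin j)))) forward))

  ∈-forward : ∀ {q} → inj₂ q ∈ indices → Forward q
  ∈-forward q∈ with ∈.∈-++⁻ (map inj₁ copies) q∈
  ... | inj₁ ∈copies with ∈.∈-map⁻ inj₁ ∈copies
  ...   | _ , _ , ()
  ∈-forward q∈ | inj₂ ∈crosses with ∈.∈-map⁻ inj₂ ∈crosses
  ...   | _ , q∈′ , refl = proj₂ (∈.∈-filter⁻ forward? {xs = crosses} q∈′)

  copyStar-edge⁺ : ∀ a {x y} (s : Star n e) → EdgeOf x y s →
    EdgeOf (combine a x) (combine a y) (copyStar a s)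
  copyStar-edge⁺ a s (inj₁ (refl , y∈)) = subst (λ y → EdgeOf _ (combine a y) (copyStar a s))
    (sym (AnyVₚ.lookup-index y∈)) (CopyStar.edge⁺ a s (AnyV.index y∈))
  copyStar-edge⁺ a s (inj₂ (refl , x∈)) =
    EdgeOf-sym {s = copyStar a s} (copyStar-edge⁺ a s (inj₁ (refl , x∈)))

  copyStar-edge⁻ : ∀ a {u v} (s : Star n e) → EdgeOf u v (copyStar a s) →
    ∃[ x ] ∃[ y ] (u ≡ combine a x × v ≡ combine a y × EdgeOf x y s)
  copyStar-edge⁻ a s uv∈ with CopyStar.edge⁻ a s uv∈
  ... | t , inj₁ (u≡ , v≡) = _ , _ , u≡ , v≡ , inj₁ (refl , ∈ᵥ.∈-lookup t (leaves s))
  ... | t , inj₂ (v≡ , u≡) = _ , _ , u≡ , v≡ , inj₂ (refl , ∈ᵥ.∈-lookup t (leaves s))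

  crossStar-edge⁺ : ∀ {a b} (a≢b : a ≢ b) x y →
    ∃[ q ] (source q ≡ a × target q ≡ b × EdgeOf (combine a x) (combine b y) (crossStar q))
  crossStar-edge⁺ {a} {b} a≢b x y = q , refl , Fin.punchIn-punchOut a≢b ,
    subst (λ v → EdgeOf (combine a x) v (crossStar q)) leaf≡ (CrossStar.edge⁺ q s)
    where
    d = punchOut a≢b
    j = proj₁ (from (layout x d) y)
    s = proj₂ (from (layout x d) y)
    q = a , d , x , j
    leaf≡ : crossLeaf q s ≡ combine b y
    leaf≡ = cong₂ combine (Fin.punchIn-punchOut a≢b) (strictlyInverseˡ (layout x d) y)

  covered-combine : ∀ a x b y → combine a x ≢ combine b y →
    ∃[ i ] (i ∈ indices × EdgeOf (combine a x) (combine b y) (blockAt i))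
  covered-combine a x b y ax≢by with Fin.<-cmp a b
  ... | tri≈ _ refl _ with partition S x y (ax≢by ∘ cong (combine a))
  ...   | i , xy∈i , _ = inj₁ (a , i) , copy-∈ a i , copyStar-edge⁺ a (block i) xy∈i
  covered-combine a x b y _ | tri< a<b _ _ with crossStar-edge⁺ (Fin.<⇒≢ a<b) x y
  ...   | q , refl , refl , edge = inj₂ q , cross-∈ q a<b , edge
  covered-combine a x b y _ | tri> _ _ b<a with crossStar-edge⁺ (Fin.<⇒≢ b<a) y x
  ...   | q , refl , refl , edge = inj₂ q , cross-∈ q b<a , EdgeOf-sym {s = crossStar q} edge

  covered : ∀ u v → u ≢ v → ∃[ i ] (i ∈ indices × EdgeOf u v (blockAt i))
  covered u v u≢v with Fin.combine-surjective {k} {n} u | Fin.combine-surjective {k} {n} v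
  ... | a , x , refl | b , y , refl = covered-combine a x b y u≢v

  block-covers-once : ∀ {x y} i j → EdgeOf x y (block i) → EdgeOf x y (block j) → i ≡ j
  block-covers-once {x} {y} i j xy∈i xy∈j with partition S x y (EdgeOf-≢ {s = block i} xy∈i)
  ... | _ , _ , only = trans (only i xy∈i) (sym (only j xy∈j))

  copyStars-cover-once : ∀ {u v} a i b j →
    EdgeOf u v (copyStar a (block i)) → EdgeOf u v (copyStar b (block j)) → (a , i) ≡ (b , j)
  copyStars-cover-once a i b j uv∈i uv∈j
    with copyStar-edge⁻ a (block i) uv∈i | copyStar-edge⁻ b (block j) uv∈j
  ... | x , y , refl , refl , xy∈i | x′ , y′ , u≡ , v≡ , xy∈j
    with Fin.combine-injective a x b x′ u≡ | Fin.combine-injective a y b y′ v≡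
  ... | refl , refl | _ , refl = cong (a ,_) (block-covers-once i j xy∈i xy∈j)

  copyStar-within : ∀ {u v} a s → EdgeOf u v (copyStar a s) → copyOf u ≡ copyOf v
  copyStar-within a s uv∈ with copyStar-edge⁻ a s uv∈
  ... | x , y , refl , refl , _ = trans (copyOf-combine a x) (sym (copyOf-combine a y))

  crossStar-across : ∀ {u v} q → EdgeOf u v (crossStar q) → copyOf u ≢ copyOf v
  crossStar-across q@(a , d , x , _) uv∈ with CrossStar.edge⁻ q uv∈
  ... | _ , inj₁ (refl , refl) = λ eq → Fin.punchInᵢ≢i a d
    (trans (sym (copyOf-combine (target q) _)) (trans (sym eq) (copyOf-combine a x)))
  ... | _ , inj₂ (refl , refl) = λ eq → Fin.punchInᵢ≢i a d
    (trans (sym (copyOf-combine (target q) _)) (trans eq (copyOf-combine a x)))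

  crossStar-determined : ∀ q q′ {s s′} →
    crossCentre q ≡ crossCentre q′ → crossLeaf q s ≡ crossLeaf q′ s′ → q ≡ q′
  crossStar-determined (a , d , x , j) (a′ , d′ , x′ , j′) {s} {s′} centre≡ leaf≡
    with Fin.combine-injective a x a′ x′ centre≡
  ... | refl , refl
    with Fin.punchIn-injective a d d′ (Fin.combine-injectiveˡ (punchIn a d) _ (punchIn a d′) _ leaf≡)
  ... | refl
    with Injection.injective (↔⇒↣ (layout x d)) {j , s} {j′ , s′}
           (Fin.combine-injectiveʳ (punchIn a d) _ (punchIn a d) _ leaf≡)
  ... | refl = refl

  crossStars-not-opposite : ∀ q q′ {s s′} → Forward q → Forward q′ →
    crossCentre q ≡ crossLeaf q′ s′ → crossLeaf q s ≡ crossCentre q′ → ⊥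
  crossStars-not-opposite q q′@(_ , _ , x′ , _) fwd fwd′ centre≡leaf leaf≡centre =
    Fin.<-asym fwd (subst₂ Fin._<_ source′≡target target′≡source fwd′)
    where
    source′≡target : source q′ ≡ target q
    source′≡target = trans (sym (copyOf-combine (source q′) x′))
      (trans (cong copyOf (sym leaf≡centre)) (copyOf-combine (target q) _))
    target′≡source : target q′ ≡ source q
    target′≡source = trans (sym (copyOf-combine (target q′) _))
      (trans (cong copyOf (sym centre≡leaf)) (copyOf-combine (source q) _))

  crossStars-cover-once : ∀ {u v} q q′ → Forward q → Forward q′ →
    EdgeOf u v (crossStar q) → EdgeOf u v (crossStar q′) → q ≡ q′
  crossStars-cover-once q q′ fwd fwd′ uv∈q uv∈q′
    with CrossStar.edge⁻ q uv∈q | CrossStar.edge⁻ q′ uv∈q′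
  ... | _ , inj₁ (refl , refl) | _ , inj₁ (u≡ , v≡) = crossStar-determined q q′ u≡ v≡
  ... | _ , inj₂ (refl , refl) | _ , inj₂ (v≡ , u≡) = crossStar-determined q q′ v≡ u≡
  ... | _ , inj₁ (refl , refl) | _ , inj₂ (v≡ , u≡) = ⊥-elim (crossStars-not-opposite q q′ fwd fwd′ u≡ v≡)
  ... | _ , inj₂ (refl , refl) | _ , inj₁ (u≡ , v≡) = ⊥-elim (crossStars-not-opposite q q′ fwd fwd′ v≡ u≡)

  covered-once : ∀ {u v i j} → i ∈ indices → j ∈ indices →
    EdgeOf u v (blockAt i) → EdgeOf u v (blockAt j) → i ≡ j
  covered-once {i = inj₁ (a , i)} {inj₁ (b , j)} _ _ uv∈i uv∈j =
    cong inj₁ (copyStars-cover-once a i b j uv∈i uv∈j)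
  covered-once {i = inj₁ (a , i)} {inj₂ q} _ _ uv∈i uv∈j =
    ⊥-elim (crossStar-across q uv∈j (copyStar-within a (block i) uv∈i))
  covered-once {i = inj₂ q} {inj₁ (a , j)} _ _ uv∈i uv∈j =
    ⊥-elim (crossStar-across q uv∈i (copyStar-within a (block j) uv∈j))
  covered-once {i = inj₂ q} {inj₂ q′} q∈ q′∈ uv∈i uv∈j =
    cong inj₂ (crossStars-cover-once q q′ (∈-forward q∈) (∈-forward q′∈) uv∈i uv∈j)

  open IndexedStarSystem blockAt indices indices-unique covered covered-once
    using (system; proper⁺; proper⁻) public

  copyStar-not-monochromatic : ∀ a i → ¬ Monochromatic colouring (copyStar a (block i))
  copyStar-not-monochromatic a i mono = f-proper i (AllVₚ.lookup⁻ λ t →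
    Fin.punchIn-injective a _ _ (trans (sym (colouring-combine a _))
      (trans (CopyStar.monochromatic⁻ a (block i) mono t) (colouring-combine a _))))

  crossStar-not-monochromatic : ∀ q → ¬ Monochromatic colouring (crossStar q)
  crossStar-not-monochromatic q@(a , d , x , j) mono = by-layout (f x ≟ d)
    where
    open ≡-Reasoning
    leaf : Fin e → Fin n
    leaf s = to (layout x d) (j , s)
    by-layout : Dec (f x ≡ d) → ⊥
    by-layout (yes fx≡d) = Fin.punchInᵢ≢i (target q) _ (begin
      punchIn (target q) (f (leaf zero)) ≡⟨ colouring-combine (target q) _ ⟨
      colouring (crossLeaf q zero)       ≡⟨ CrossStar.monochromatic⁻ q mono zero ⟩
      colouring (combine a x)            ≡⟨ colouring-combine a x ⟩
      punchIn a (f x)                    ≡⟨ cong (punchIn a) fx≡d ⟩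
      target q                           ∎)
    by-layout (no fx≢d) = layout-mixed fx≢d j (Fin.punchIn-injective (target q) _ _ (begin
      punchIn (target q) (f (leaf zero))       ≡⟨ colouring-combine (target q) _ ⟨
      colouring (crossLeaf q zero)             ≡⟨ CrossStar.monochromatic⁻ q mono zero ⟩
      colouring (combine a x)                  ≡⟨ CrossStar.monochromatic⁻ q mono (suc zero) ⟨
      colouring (crossLeaf q (suc zero))       ≡⟨ colouring-combine (target q) _ ⟩
      punchIn (target q) (f (leaf (suc zero))) ∎))

  colouring-proper : Proper system k colouring
  colouring-proper = proper⁺ colouring not-monochromatic
    where
    not-monochromatic : ∀ {i} → i ∈ indices → ¬ Monochromatic colouring (blockAt i)
    not-monochromatic {inj₁ (a , i)} _ = copyStar-not-monochromatic a i
    not-monochromatic {inj₂ q}       _ = crossStar-not-monochromatic q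

  colouring-combine≡⇔ : ∀ {a b} (a≢b : a ≢ b) x → colouring (combine a x) ≡ b ⇔ f x ≡ punchOut a≢b
  colouring-combine≡⇔ {a} a≢b x = mk⇔
    (λ eq → Fin.punchIn-injective a _ _
      (trans (sym (colouring-combine a x)) (trans eq (sym (Fin.punchIn-punchOut a≢b)))))
    (λ eq → trans (colouring-combine a x) (trans (cong (punchIn a) eq) (Fin.punchIn-punchOut a≢b)))

  colouring-classSize : ∀ b → classSize colouring b ≡ K * m
  colouring-classSize b =
    trans (classSize≡count colouring b)
      (count-combine-missing K {n} (λ v → colouring v ≟ b) b missing present)
    where
    missing : count (λ x → colouring (combine {k} {n} b x) ≟ b) ≡ 0
    missing = count-none _ λ x eq → Fin.punchInᵢ≢i b (f x) (trans (sym (colouring-combine b x)) eq)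
    present : ∀ a → a ≢ b → count (λ x → colouring (combine {k} {n} a x) ≟ b) ≡ m
    present a a≢b = begin
      count (λ x → colouring (combine {k} {n} a x) ≟ b) ≡⟨ count-⇔ _ _ (colouring-combine≡⇔ a≢b) ⟩
      count (λ x → f x ≟ punchOut a≢b)                  ≡⟨ classSize≡count f _ ⟨
      classSize f (punchOut a≢b)                        ≡⟨ classSize≡e+r _ ⟩
      m                                                 ∎
      where open ≡-Reasoning

  colouring-equitable : StronglyEquitable colouring
  colouring-equitable i j = trans (colouring-classSize i) (sym (colouring-classSize j))

  system-not-K-colourable : UniquelyColourable S K → ¬ Colourable system K
  system-not-K-colourable uniquely (h , h-proper) =
    proper⁻ h h-proper (cross-∈ q (s≤s z≤n)) (CrossStar.monochromatic⁺ q leaves-agree)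
    where
    copy-proper : ∀ a → Proper S K (h ∘ combine a)
    copy-proper a i mono =
      proper⁻ h h-proper (copy-∈ a i) (CopyStar.monochromatic⁺ a (block i) (AllVₚ.lookup⁺ mono))
    π : Fin k → Permutation′ K
    π a = proj₁ (uniquely f (h ∘ combine a) f-proper (copy-proper a))
    h≡π∘f : ∀ a x → h (combine a x) ≡ π a ⟨$⟩ʳ f x
    h≡π∘f a = proj₂ (uniquely f (h ∘ combine a) f-proper (copy-proper a))
    x₀ : Fin n
    x₀ = to enumeration (zero , zero)
    b : Fin k
    b = suc (f x₀)
    i : Fin K
    i = π b ⟨$⟩ˡ (π zero ⟨$⟩ʳ f x₀)
    q : Cross
    q = zero , f x₀ , x₀ , i ↑ˡ c′
    leaves-agree : ∀ s → h (crossLeaf q s) ≡ h (crossCentre q)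
    leaves-agree s = begin
      h (crossLeaf q s)                                ≡⟨ h≡π∘f b _ ⟩
      π b ⟨$⟩ʳ f (to (layout x₀ (f x₀)) (i ↑ˡ c′ , s)) ≡⟨ cong (π b ⟨$⟩ʳ_) (layout-pure refl i s) ⟩
      π b ⟨$⟩ʳ i                                       ≡⟨ inverseʳ (π b) ⟩
      π zero ⟨$⟩ʳ f x₀                                 ≡⟨ h≡π∘f zero x₀ ⟨
      h (crossCentre q)                                ∎
      where open ≡-Reasoning

theorem4p3 : ∀ (k e : ℕ) → 3 ≤ k → 3 ≤ e →
    (Σ ℕ λ n → (2 * e) ∣ n × Σ (StarSystem n e) λ S →
       Chromatic S (k ∸ 1) × UniquelyColourable S (k ∸ 1) ×
       Σ (Fin n → Fin (k ∸ 1)) λ f →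
         Proper S (k ∸ 1) f × StronglyEquitable f × (∀ i → e < classSize f i)) →
    Σ ℕ λ n′ → (2 * e) ∣ n′ × Σ (StarSystem n′ e) λ S′ →
      Chromatic S′ k × Σ (Fin n′ → Fin k) λ g → Proper S′ k g × StronglyEquitable g
theorem4p3 k@(suc K@(suc (suc _))) e@(suc (suc _)) (s≤s (s≤s (s≤s _))) (s≤s (s≤s (s≤s _)))
  (n , 2e∣n , S , _ , uniquely , f , f-proper , f-equitable , e<classSize) =
  k * n , ∣n⇒∣m*n k 2e∣n , system ,
  ((colouring , colouring-proper) , system-not-K-colourable uniquely) ,
  colouring , colouring-proper , colouring-equitable
  where
  r : ℕ
  r = classSize f zero ∸ e
  classSize≡e+r : ∀ i → classSize f i ≡ e + r
  classSize≡e+r i = trans (f-equitable i zero) (sym (ℕ.m+[n∸m]≡n (ℕ.<⇒≤ (e<classSize zero))))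
  e∣Kr : e ∣ K * r
  e∣Kr = ∣m*[n+o]⇒∣m*o K
    (subst (e ∣_) (sym (ClassEnumeration.order f classSize≡e+r)) (∣-trans (n∣m*n 2) 2e∣n))
  open Construction {c′ = _∣_.quotient e∣Kr} S f f-proper classSize≡e+r (sym (_∣_.equality e∣Kr))
    using (system; colouring; colouring-proper; colouring-equitable; system-not-K-colourable)
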